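{- Let $A$ be a finite alphabet with $|A|\ge2$. For every $k\geq 1$, the $k$-th classes $\Sigma_1(k)$ and $\mathrm{co}\Sigma_1(k)$ of the boolean hierarchy over the class of $\mathrm{FO}[<]$-definable-by-$\Sigma_1$ languages are decidable: given a deterministic finite automaton $F$ over $A$, one can decide whether $L(F)\in\Sigma_1(k)$ and whether $L(F)\in\mathrm{co}\Sigma_1(k)$.
   Context: $\mathrm{FO}[<]$ formulas over $A$ are built from atomic formulas $x<y$, $x=y$, $\pi_a x$ ($a\in A$) with $\neg,\vee,\wedge,\exists,\forall$; a word $w$ is a structure with universe $\{1,\dots,|w|\}$, the usual order, and $\pi_a x$ meaning the letter at position $x$ is $a$. A language $L\subseteq A^*$ is defined by a sentence $\phi$ if $L=\{w: w\models\phi\}$. $\Sigma_1$ is the class of formulas of the form $\exists x_1\cdots\exists x_n\,\psi$ with $\psi$ quantifier-free (equivalently, formulas with at most $0$ quantifier alternations starting with $\exists$). Let $\mathcal{S}$ be the class of languages definable by $\Sigma_1$ sentences; $\Sigma_1(k)=\{L_1\triangle\cdots\triangle L_k: L_i\in\mathcal{S}\}$ ($\triangle$ = symmetric difference) and $\mathrm{co}\Sigma_1(k)=\{A^*\setminus L: L\in\Sigma_1(k)\}$. -}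

module Defs where

open import Data.Nat using (ℕ; zero; suc)
open import Data.Fin using (Fin; _<_)
open import Data.List using (List; []; _∷_; length; lookup)
open import Data.Vec using (Vec; []; _∷_)
open import Data.Bool using (Bool; true; false)
open import Data.Product using (Σ; _×_)
open import Data.Sum using (_⊎_)
open import Data.Empty using (⊥)
open import Relation.Nullary using (¬_)
open import Relation.Binary.PropositionalEquality using (_≡_)
open import Function.Bundles using (_⇔_)

Word : ℕ → Set
Word n = List (Fin n)

Language : ℕ → Set₁
Language n = Word n → Set

data QF (n m : ℕ) : Set where
  _<'_ : Fin m → Fin m → QF n m
  _='_ : Fin m → Fin m → QF n m
  π    : Fin n → Fin m → QF n m
  ¬'_  : QF n m → QF n m
  _∨'_ : QF n m → QF n m → QF n m
  _∧'_ : QF n m → QF n m → QF n m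

-- Semantics: positions of w are Fin (length w) (i.e. {1,…,|w|} shifted by one),
-- with the usual order; π a x means the letter at x is a.
⟦_⟧ : ∀ {n m} → QF n m → (w : Word n) → (Fin m → Fin (length w)) → Set
⟦ x <' y ⟧ w ρ = ρ x < ρ y
⟦ x =' y ⟧ w ρ = ρ x ≡ ρ y
⟦ π a x ⟧ w ρ = lookup w (ρ x) ≡ a
⟦ ¬' φ ⟧ w ρ = ¬ ⟦ φ ⟧ w ρ
⟦ φ ∨' ψ ⟧ w ρ = ⟦ φ ⟧ w ρ ⊎ ⟦ ψ ⟧ w ρ
⟦ φ ∧' ψ ⟧ w ρ = ⟦ φ ⟧ w ρ × ⟦ ψ ⟧ w ρ

record Σ₁Sentence (n : ℕ) : Set where
  constructor ∃⋯
  field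
    nvars  : ℕ
    matrix : QF n nvars

_⊨_ : ∀ {n} → Word n → Σ₁Sentence n → Set
w ⊨ ∃⋯ m ψ = Σ (Fin m → Fin (length w)) λ ρ → ⟦ ψ ⟧ w ρ

_△_ : ∀ {n} → Language n → Language n → Language n
(L △ K) w = (L w × ¬ K w) ⊎ (¬ L w × K w)

∅L : ∀ {n} → Language n
∅L w = ⊥

SymDiff : ∀ {n k} → Vec (Σ₁Sentence n) k → Language n
SymDiff []       = ∅L
SymDiff (φ ∷ φs) = (λ w → w ⊨ φ) △ SymDiff φs

InΣ₁ : ∀ {n} → ℕ → Language n → Set
InΣ₁ {n} k L = Σ (Vec (Σ₁Sentence n) k) λ φs → ∀ w → L w ⇔ SymDiff φs w

∁ : ∀ {n} → Language n → Language n
∁ L w = ¬ L w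

InCoΣ₁ : ∀ {n} → ℕ → Language n → Set
InCoΣ₁ k L = InΣ₁ k (∁ L)

record DFA (n : ℕ) : Set where
  field
    Q       : ℕ
    initial : Fin Q
    δ       : Fin Q → Fin n → Fin Q
    final   : Fin Q → Bool

run : ∀ {n} (F : DFA n) → Fin (DFA.Q F) → Word n → Fin (DFA.Q F)
run F q []       = q
run F q (a ∷ w)  = run F (DFA.δ F q a) w

L[_] : ∀ {n} → DFA n → Language n
L[ F ] w = DFA.final F (run F (DFA.initial F) w) ≡ true

{-# OPTIONS --safe #-}

-- A Σ₁ sentence is preserved along order embeddings of words, so Σ₁ languages are upward closed
-- for the subword order ⊆ and never contain ε; conversely the upward closure of a nonempty word
-- is defined by ∃x₁<⋯<xₘ with the letters of the word, and finite unions of Σ₁ languages are Σ₁.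
-- If L = L₁ △ ⋯ △ Lₖ with Lᵢ ∈ Σ₁, the number of Lᵢ containing w is monotone in w, at most k,
-- and odd iff w ∈ L; so ε ∉ L and there is no alternating chain w₀ ⊆ w₁ ⊆ ⋯ ⊆ wₖ (wⱼ ∈ L iff
-- j is even). Conversely, if L is regular and has neither, let Gᵢ be the set of words above an
-- alternating chain of length i: the Gᵢ decrease, G₀ is everything, Gₖ₊₁ is empty, and w ∈ L
-- iff the largest i with w ∈ Gᵢ is odd, so L = G₁ △ ⋯ △ Gₖ. Reading a chain as one word whose
-- letters are annotated with the level at which they enter, the states of the automaton on all
-- levels form a right congruence with |Q|ⁱ classes. Pumping then shows that Gᵢ is the upward
-- closure of its chains of length at most |Q|ⁱ, hence Σ₁, and that the existence of an
-- alternating chain of length k + 1 is decidable. Finally coΣ₁(k) is Σ₁(k) for the complemented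
-- automaton.
module Submission where

open import Defs
open import Data.Nat using (ℕ; _≤_)
open import Data.Product using (_×_)
open import Relation.Nullary using (Dec)

open import Data.Bool using (Bool; true; false; not)
open import Data.Bool.Properties using (¬-not; not-¬; not-injective; not-involutive; ⇔→≡)
  renaming (_≟_ to _≟ᵇ_)
open import Data.Empty using (⊥-elim)
open import Data.Fin as Fin using (Fin; zero; suc; toℕ; _↑ˡ_; _↑ʳ_; combine)
open import Data.Fin.Properties as Finₚ using (suc-injective; pigeonhole; combine-injective)
  renaming (_<?_ to _<ᶠ?_; _≟_ to _≟ᶠ_)
open import Data.List using (List; []; _∷_; length; lookup; _++_; map; filter; take; drop;
  cartesianProductWith; cartesianProduct; allFin; upTo)
open import Data.List.Properties
  using (length-take; length-drop; length-map; length-++; take++drop≡id; map-∘)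
open import Data.List.Membership.Propositional using (_∈_; find; lose)
open import Data.List.Membership.Propositional.Properties
  using (∈-allFin; ∈-filter⁺; ∈-filter⁻; ∈-cartesianProductWith⁺; ∈-cartesianProduct⁺; ∈-upTo⁺)
open import Data.List.Relation.Binary.Sublist.Propositional
  using (_⊆_; []; _∷_; _∷ʳ_; ⊆-refl; ⊆-trans; minimum)
open import Data.List.Relation.Binary.Sublist.Propositional.Properties
  using (++⁺; take⁺; drop⁺-≥; drop-⊆; map⁺)
open import Data.List.Relation.Unary.All as All using (All; []; _∷_)
import Data.List.Relation.Unary.All.Properties as All
open import Data.List.Relation.Unary.Any as Any using (Any; here; there)
import Data.List.Relation.Unary.Any.Properties as Any
open import Data.Nat using (zero; suc; _+_; _∸_; _^_; _⊓_; _<_; _≤?_; z≤n; s≤s)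
open import Data.Nat.Induction using (<-wellFounded)
open import Data.Nat.Properties
  using (≤-refl; ≤-trans; ≤-<-trans; <⇒≤; <⇒≱; ≰⇒>; ≤∧≢⇒<; m≤n⇒m≤1+n; +-suc; +-identityʳ;
         m⊓n≤m; m⊓n≤n; ⊓-glb; +-monoˡ-≤; +-monoˡ-<; m+[n∸m]≡n; module ≤-Reasoning)
open import Data.Product using (Σ; ∃; _,_; proj₁; proj₂)
import Data.Product as Product
open import Data.Sum using (_⊎_; inj₁; inj₂; [_,_]′)
import Data.Sum as Sum
open import Data.Unit using (⊤; tt)
open import Data.Vec using (Vec; []; _∷_; count)
open import Data.Vec.Properties using (count≤n)
open import Data.Vec.Functional using (Vector; tail) renaming (_∷_ to _◁_; _++_ to _⊕_)
open import Data.Vec.Functional.Properties using (lookup-++ˡ; lookup-++ʳ)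
open import Function using (id; _∘_; const)
open import Function.Bundles using (_⇔_; mk⇔; Equivalence)
import Function.Properties.Equivalence as ⇔
open import Induction.WellFounded using (Acc; acc)
open import Relation.Binary.PropositionalEquality
open import Relation.Nullary using (¬_; yes; no; contradiction; ¬?)
open import Relation.Nullary.Decidable using (map′; _×-dec_; _⊎-dec_)
open import Relation.Unary using (Decidable)

private
  variable
    A : Set
    n m m′ k d i j s ℓ : ℕ
    u w : Word n

open Equivalence using (to; from)

⟦⟧-cong : (ψ : QF n m) (w : Word n) {ρ σ : Fin m → Fin (length w)} →
          (∀ i → ρ i ≡ σ i) → ⟦ ψ ⟧ w ρ ≡ ⟦ ψ ⟧ w σ
⟦⟧-cong (x <' y) w e = cong₂ Fin._<_ (e x) (e y)
⟦⟧-cong (x =' y) w e = cong₂ _≡_ (e x) (e y)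
⟦⟧-cong (π a x) w e = cong (λ p → lookup w p ≡ a) (e x)
⟦⟧-cong (¬' ψ) w e = cong ¬_ (⟦⟧-cong ψ w e)
⟦⟧-cong (ψ ∨' χ) w e = cong₂ _⊎_ (⟦⟧-cong ψ w e) (⟦⟧-cong χ w e)
⟦⟧-cong (ψ ∧' χ) w e = cong₂ _×_ (⟦⟧-cong ψ w e) (⟦⟧-cong χ w e)

⟦_⟧? : (ψ : QF n m) (w : Word n) (ρ : Fin m → Fin (length w)) → Dec (⟦ ψ ⟧ w ρ)
⟦ x <' y ⟧? w ρ = ρ x <ᶠ? ρ y
⟦ x =' y ⟧? w ρ = ρ x ≟ᶠ ρ y
⟦ π a x ⟧? w ρ = lookup w (ρ x) ≟ᶠ a
⟦ ¬' ψ ⟧? w ρ = ¬? (⟦ ψ ⟧? w ρ)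
⟦ ψ ∨' χ ⟧? w ρ = ⟦ ψ ⟧? w ρ ⊎-dec ⟦ χ ⟧? w ρ
⟦ ψ ∧' χ ⟧? w ρ = ⟦ ψ ⟧? w ρ ×-dec ⟦ χ ⟧? w ρ

rename : (Fin m → Fin m′) → QF n m → QF n m′
rename f (x <' y) = f x <' f y
rename f (x =' y) = f x =' f y
rename f (π a x) = π a (f x)
rename f (¬' ψ) = ¬' rename f ψ
rename f (ψ ∨' χ) = rename f ψ ∨' rename f χ
rename f (ψ ∧' χ) = rename f ψ ∧' rename f χ

⟦rename⟧ : (f : Fin m → Fin m′) (ψ : QF n m) (w : Word n) (ρ : Fin m′ → Fin (length w)) →
           ⟦ rename f ψ ⟧ w ρ ≡ ⟦ ψ ⟧ w (ρ ∘ f)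
⟦rename⟧ f (x <' y) w ρ = refl
⟦rename⟧ f (x =' y) w ρ = refl
⟦rename⟧ f (π a x) w ρ = refl
⟦rename⟧ f (¬' ψ) w ρ = cong ¬_ (⟦rename⟧ f ψ w ρ)
⟦rename⟧ f (ψ ∨' χ) w ρ = cong₂ _⊎_ (⟦rename⟧ f ψ w ρ) (⟦rename⟧ f χ w ρ)
⟦rename⟧ f (ψ ∧' χ) w ρ = cong₂ _×_ (⟦rename⟧ f ψ w ρ) (⟦rename⟧ f χ w ρ)

-- There are no constants, so every formula has a variable: this is why no Σ₁ sentence holds
-- in the empty word.
some-variable : QF n m → Fin m
some-variable (x <' _) = x
some-variable (x =' _) = x
some-variable (π _ x) = x
some-variable (¬' ψ) = some-variable ψ
some-variable (ψ ∨' _) = some-variable ψ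
some-variable (ψ ∧' _) = some-variable ψ

⊨-position : (φ : Σ₁Sentence n) → w ⊨ φ → Fin (length w)
⊨-position (∃⋯ m ψ) (ρ , _) = ρ (some-variable ψ)

[]⊭ : (φ : Σ₁Sentence n) → ¬ ([] ⊨ φ)
[]⊭ φ p with ⊨-position φ p
... | ()

-- Without function extensionality, P has to respect pointwise equality.
∃-Vector? : ∀ {l} m (P : Vector (Fin l) m → Set) →
            (∀ {ρ σ} → (∀ i → ρ i ≡ σ i) → P ρ → P σ) →
            (∀ ρ → Dec (P ρ)) → Dec (∃ P)
∃-Vector? zero P resp P? = map′ (_ ,_) (λ (_ , p) → resp (λ ()) p) (P? (λ ()))
∃-Vector? (suc m) P resp P? =
  map′ (λ (a , ρ , p) → a ◁ ρ , p)
       (λ (ρ , p) → ρ zero , tail ρ , resp (λ { zero → refl ; (suc i) → refl }) p)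
       (Finₚ.any? λ a → ∃-Vector? m (P ∘ (a ◁_))
                      (λ e → resp λ { zero → refl ; (suc i) → e i }) (P? ∘ (a ◁_)))

_⊨?_ : (w : Word n) (φ : Σ₁Sentence n) → Dec (w ⊨ φ)
w ⊨? ∃⋯ m ψ = ∃-Vector? m (⟦ ψ ⟧ w) (λ e → subst id (⟦⟧-cong ψ w e)) (⟦ ψ ⟧? w)

⊥ₛ : Σ₁Sentence n
⊥ₛ = ∃⋯ 1 (¬' (zero =' zero))

⊭⊥ₛ : ¬ (w ⊨ ⊥ₛ)
⊭⊥ₛ (_ , x≢x) = x≢x refl

_∨ₛ_ : Σ₁Sentence n → Σ₁Sentence n → Σ₁Sentence n
∃⋯ m₁ ψ₁ ∨ₛ ∃⋯ m₂ ψ₂ = ∃⋯ (m₁ + m₂) (rename (_↑ˡ m₂) ψ₁ ∨' rename (m₁ ↑ʳ_) ψ₂)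

∨ₛ⁻ : (φ₁ φ₂ : Σ₁Sentence n) → w ⊨ (φ₁ ∨ₛ φ₂) → w ⊨ φ₁ ⊎ w ⊨ φ₂
∨ₛ⁻ {w = w} (∃⋯ m₁ ψ₁) (∃⋯ m₂ ψ₂) (ρ , inj₁ p) = inj₁ (_ , subst id (⟦rename⟧ _ ψ₁ w ρ) p)
∨ₛ⁻ {w = w} (∃⋯ m₁ ψ₁) (∃⋯ m₂ ψ₂) (ρ , inj₂ p) = inj₂ (_ , subst id (⟦rename⟧ _ ψ₂ w ρ) p)

∨ₛ⁺ : (φ₁ φ₂ : Σ₁Sentence n) → w ⊨ φ₁ ⊎ w ⊨ φ₂ → w ⊨ (φ₁ ∨ₛ φ₂)
∨ₛ⁺ {w = w} φ₁@(∃⋯ m₁ ψ₁) (∃⋯ m₂ ψ₂) (inj₁ (σ , p)) =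
  σ ⊕ τ ,
  inj₁ (subst id (sym (⟦rename⟧ _ ψ₁ w _)) (subst id (⟦⟧-cong ψ₁ w (sym ∘ lookup-++ˡ σ τ)) p))
  where
  τ : Vector (Fin (length w)) m₂
  τ = const (⊨-position φ₁ (σ , p))
∨ₛ⁺ {w = w} (∃⋯ m₁ ψ₁) φ₂@(∃⋯ m₂ ψ₂) (inj₂ (τ , p)) =
  σ ⊕ τ ,
  inj₂ (subst id (sym (⟦rename⟧ _ ψ₂ w _)) (subst id (⟦⟧-cong ψ₂ w (sym ∘ lookup-++ʳ σ τ)) p))
  where
  σ : Vector (Fin (length w)) m₁
  σ = const (⊨-position φ₂ (τ , p))

⋁ : List (Σ₁Sentence n) → Σ₁Sentence n
⋁ [] = ⊥ₛ
⋁ (φ ∷ φs) = φ ∨ₛ ⋁ φs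

⋁⁺ : {φs : List (Σ₁Sentence n)} → Any (w ⊨_) φs → w ⊨ ⋁ φs
⋁⁺ {w = w} {φ ∷ φs} (here p) = ∨ₛ⁺ {w = w} φ (⋁ φs) (inj₁ p)
⋁⁺ {w = w} {φ ∷ φs} (there p) = ∨ₛ⁺ {w = w} φ (⋁ φs) (inj₂ (⋁⁺ p))

⋁⁻ : (φs : List (Σ₁Sentence n)) → w ⊨ ⋁ φs → Any (w ⊨_) φs
⋁⁻ {w = w} [] p = ⊥-elim (⊭⊥ₛ {w = w} p)
⋁⁻ {w = w} (φ ∷ φs) p = [ here , there ∘ ⋁⁻ φs ]′ (∨ₛ⁻ {w = w} φ (⋁ φs) p)

-- Embeddings of words

embed : u ⊆ w → Fin (length u) → Fin (length w)
embed (_ ∷ʳ s) i = suc (embed s i)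
embed (_ ∷ s) zero = zero
embed (_ ∷ s) (suc i) = suc (embed s i)

embed-⊆-refl : (u : Word n) (i : Fin (length u)) → embed (⊆-refl {x = u}) i ≡ i
embed-⊆-refl (_ ∷ u) zero = refl
embed-⊆-refl (_ ∷ u) (suc i) = cong suc (embed-⊆-refl u i)

embed-<⁺ : (s : u ⊆ w) {i j : Fin (length u)} → i Fin.< j → embed s i Fin.< embed s j
embed-<⁺ (_ ∷ʳ s) i<j = s≤s (embed-<⁺ s i<j)
embed-<⁺ (_ ∷ s) {zero} {suc j} _ = s≤s z≤n
embed-<⁺ (_ ∷ s) {suc i} {suc j} (s≤s i<j) = s≤s (embed-<⁺ s i<j)

embed-<⁻ : (s : u ⊆ w) {i j : Fin (length u)} → embed s i Fin.< embed s j → i Fin.< j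
embed-<⁻ (_ ∷ʳ s) (s≤s p) = embed-<⁻ s p
embed-<⁻ (_ ∷ s) {zero} {suc j} _ = s≤s z≤n
embed-<⁻ (_ ∷ s) {suc i} {suc j} (s≤s p) = s≤s (embed-<⁻ s p)

embed-injective : (s : u ⊆ w) {i j : Fin (length u)} → embed s i ≡ embed s j → i ≡ j
embed-injective (_ ∷ʳ s) p = embed-injective s (suc-injective p)
embed-injective (_ ∷ s) {zero} {zero} _ = refl
embed-injective (_ ∷ s) {suc i} {suc j} p = cong suc (embed-injective s (suc-injective p))

embed-lookup : (s : u ⊆ w) (i : Fin (length u)) → lookup w (embed s i) ≡ lookup u i
embed-lookup (_ ∷ʳ s) i = embed-lookup s i
embed-lookup (refl ∷ s) zero = refl
embed-lookup (refl ∷ s) (suc i) = embed-lookup s i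

module _ {u w : Word n} (s : u ⊆ w) where
  mutual
    ⟦⟧-embed⁺ : (ψ : QF n m) (ρ : Fin m → Fin (length u)) → ⟦ ψ ⟧ u ρ → ⟦ ψ ⟧ w (embed s ∘ ρ)
    ⟦⟧-embed⁺ (x <' y) ρ = embed-<⁺ s
    ⟦⟧-embed⁺ (x =' y) ρ = cong (embed s)
    ⟦⟧-embed⁺ (π a x) ρ = trans (embed-lookup s (ρ x))
    ⟦⟧-embed⁺ (¬' ψ) ρ ¬p = ¬p ∘ ⟦⟧-embed⁻ ψ ρ
    ⟦⟧-embed⁺ (ψ ∨' χ) ρ = Sum.map (⟦⟧-embed⁺ ψ ρ) (⟦⟧-embed⁺ χ ρ)
    ⟦⟧-embed⁺ (ψ ∧' χ) ρ = Product.map (⟦⟧-embed⁺ ψ ρ) (⟦⟧-embed⁺ χ ρ)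

    ⟦⟧-embed⁻ : (ψ : QF n m) (ρ : Fin m → Fin (length u)) → ⟦ ψ ⟧ w (embed s ∘ ρ) → ⟦ ψ ⟧ u ρ
    ⟦⟧-embed⁻ (x <' y) ρ = embed-<⁻ s
    ⟦⟧-embed⁻ (x =' y) ρ = embed-injective s
    ⟦⟧-embed⁻ (π a x) ρ = trans (sym (embed-lookup s (ρ x)))
    ⟦⟧-embed⁻ (¬' ψ) ρ ¬p = ¬p ∘ ⟦⟧-embed⁺ ψ ρ
    ⟦⟧-embed⁻ (ψ ∨' χ) ρ = Sum.map (⟦⟧-embed⁻ ψ ρ) (⟦⟧-embed⁻ χ ρ)
    ⟦⟧-embed⁻ (ψ ∧' χ) ρ = Product.map (⟦⟧-embed⁻ ψ ρ) (⟦⟧-embed⁻ χ ρ)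

  ⊨-mono : (φ : Σ₁Sentence n) → u ⊨ φ → w ⊨ φ
  ⊨-mono (∃⋯ m ψ) (ρ , p) = embed s ∘ ρ , ⟦⟧-embed⁺ ψ ρ p

drop-lookup : (xs : List A) (p : Fin (length xs)) →
              drop (toℕ p) xs ≡ lookup xs p ∷ drop (suc (toℕ p)) xs
drop-lookup (x ∷ xs) zero = refl
drop-lookup (x ∷ xs) (suc p) = drop-lookup xs p

-- Variable i is the position of the i-th letter of a ∷ u.
occurrence : Fin n → (u : Word n) → QF n (suc (length u))
occurrence a [] = π a zero
occurrence a (b ∷ u) = π a zero ∧' ((zero <' suc zero) ∧' rename suc (occurrence b u))

-- ↑ [] would be the full language, which is not Σ₁ (see []⊭).
↑ : Word n → Σ₁Sentence n
↑ [] = ⊥ₛ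
↑ (a ∷ u) = ∃⋯ (suc (length u)) (occurrence a u)

occurrence-sound : (a : Fin n) (u : Word n) (ρ : Fin (suc (length u)) → Fin (length w)) →
                   ⟦ occurrence a u ⟧ w ρ → a ∷ u ⊆ drop (toℕ (ρ zero)) w
occurrence-sound {w = w} a [] ρ wₚ≡a =
  subst (a ∷ [] ⊆_) (sym (drop-lookup w (ρ zero))) (sym wₚ≡a ∷ minimum _)
occurrence-sound {w = w} a (b ∷ u) ρ (wₚ≡a , p<q , rest) =
  subst (a ∷ b ∷ u ⊆_) (sym (drop-lookup w (ρ zero)))
        (sym wₚ≡a ∷ ⊆-trans (occurrence-sound b u (ρ ∘ suc) (subst id (⟦rename⟧ suc _ w ρ) rest))
                            (drop⁺-≥ p<q))

occurrence-self : (a : Fin n) (u : Word n) → ⟦ occurrence a u ⟧ (a ∷ u) id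
occurrence-self a [] = refl
occurrence-self a (b ∷ u) = refl , s≤s z≤n , subst id (sym (⟦rename⟧ suc _ (a ∷ b ∷ u) id)) shifted
  where
  shifted : ⟦ occurrence b u ⟧ (a ∷ b ∷ u) suc
  shifted = subst id (⟦⟧-cong (occurrence b u) (a ∷ b ∷ u) (cong suc ∘ embed-⊆-refl (b ∷ u)))
                  (⟦⟧-embed⁺ (a ∷ʳ ⊆-refl) (occurrence b u) id (occurrence-self b u))

↑-sound : (u : Word n) → w ⊨ ↑ u → u ⊆ w
↑-sound {w = w} [] p = ⊥-elim (⊭⊥ₛ {w = w} p)
↑-sound {w = w} (a ∷ u) (ρ , p) = ⊆-trans (occurrence-sound a u ρ p) (drop-⊆ (toℕ (ρ zero)) w)

↑-complete : {a : Fin n} → a ∷ u ⊆ w → w ⊨ ↑ (a ∷ u)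
↑-complete {u = u} {a = a} s = ⊨-mono s (↑ (a ∷ u)) (id , occurrence-self a u)

odd : ℕ → Bool
odd zero = false
odd (suc i) = not (odd i)

not≡true⇔≢true : {b : Bool} → not b ≡ true ⇔ b ≢ true
not≡true⇔≢true {b} = mk⇔ (λ nb b≡t → not-¬ b≡t (not-injective nb)) (cong not ∘ ¬-not)

#⊨ : Vec (Σ₁Sentence n) k → Word n → ℕ
#⊨ φs w = count (w ⊨?_) φs

SymDiff⇔odd : (φs : Vec (Σ₁Sentence n) k) (w : Word n) → SymDiff φs w ⇔ odd (#⊨ φs w) ≡ true
SymDiff⇔odd [] w = mk⇔ (λ ()) (λ ())
SymDiff⇔odd (φ ∷ φs) w with w ⊨? φ | SymDiff⇔odd φs w
... | yes p | ih = mk⇔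
  (λ { (inj₁ (_ , ¬q)) → from not≡true⇔≢true (¬q ∘ from ih)
     ; (inj₂ (¬p , _)) → contradiction p ¬p })
  (λ e → inj₁ (p , to not≡true⇔≢true e ∘ to ih))
... | no ¬p | ih = mk⇔
  (λ { (inj₁ (p , _)) → contradiction p ¬p ; (inj₂ (_ , q)) → to ih q })
  (λ e → inj₂ (¬p , from ih e))

#⊨-mono : (φs : Vec (Σ₁Sentence n) k) → u ⊆ w → #⊨ φs u ≤ #⊨ φs w
#⊨-mono [] s = z≤n
#⊨-mono {u = u} {w = w} (φ ∷ φs) s with u ⊨? φ | w ⊨? φ
... | yes _ | yes _ = s≤s (#⊨-mono φs s)
... | yes p | no ¬p = contradiction (⊨-mono s φ p) ¬p
... | no _ | yes _ = m≤n⇒m≤1+n (#⊨-mono φs s)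
... | no _ | no _ = #⊨-mono φs s

InΣ₁-cong : {L K : Language n} → (∀ w → L w ⇔ K w) → InΣ₁ k L → InΣ₁ k K
InΣ₁-cong L⇔K (φs , L⇔φs) = φs , λ w → ⇔.trans (⇔.sym (L⇔K w)) (L⇔φs w)

InΣ₁⇒[]∉ : {L : Language n} → InΣ₁ k L → ¬ L []
InΣ₁⇒[]∉ (φs , L⇔φs) = []∉SymDiff φs ∘ to (L⇔φs [])
  where
  []∉SymDiff : (φs : Vec (Σ₁Sentence n) k) → ¬ SymDiff φs []
  []∉SymDiff (φ ∷ φs) (inj₁ (p , _)) = []⊭ φ p
  []∉SymDiff (φ ∷ φs) (inj₂ (_ , q)) = []∉SymDiff φs q

-- Pumping

module _ {N : ℕ} (f : List A → Fin N)
         (f-++ : ∀ {x y} z → f x ≡ f y → f (x ++ z) ≡ f (y ++ z)) where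

  -- Two of the length x + 1 prefixes of x have the same image; cut out the factor between them.
  shorter-subword : (x : List A) → N ≤ length x →
                    ∃ λ x′ → length x′ < length x × x′ ⊆ x × f x′ ≡ f x
  shorter-subword x N≤∣x∣ with pigeonhole (s≤s N≤∣x∣) (λ p → f (take (toℕ p) x))
  ... | p , q , p<q , same-image =
    x′ , shorter , x′⊆x , trans (f-++ (drop (toℕ q) x) same-image) (cong f split)
    where
    x′ : List A
    x′ = take (toℕ p) x ++ drop (toℕ q) x
    split : take (toℕ q) x ++ drop (toℕ q) x ≡ x
    split = take++drop≡id (toℕ q) x
    x′⊆x : x′ ⊆ x
    x′⊆x = subst (x′ ⊆_) split (++⁺ (take⁺ (<⇒≤ p<q)) ⊆-refl)
    shorter : length x′ < length x
    shorter = begin-strict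
      length x′                                          ≡⟨ length-++ (take (toℕ p) x) ⟩
      length (take (toℕ p) x) + length (drop (toℕ q) x)
        ≡⟨ cong₂ _+_ (length-take (toℕ p) x) (length-drop (toℕ q) x) ⟩
      toℕ p ⊓ length x + (length x ∸ toℕ q)             ≤⟨ +-monoˡ-≤ _ (m⊓n≤m (toℕ p) _) ⟩
      toℕ p + (length x ∸ toℕ q)                        <⟨ +-monoˡ-< _ p<q ⟩
      toℕ q + (length x ∸ toℕ q)                        ≡⟨ m+[n∸m]≡n (Finₚ.toℕ≤pred[n] q) ⟩
      length x                                           ∎
      where open ≤-Reasoning

  short-subword : (x : List A) → ∃ λ x′ → length x′ < N × x′ ⊆ x × f x′ ≡ f x
  short-subword x = go x (<-wellFounded (length x))
    where
    go : (x : List A) → Acc _<_ (length x) → ∃ λ x′ → length x′ < N × x′ ⊆ x × f x′ ≡ f x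
    go x (acc rec) with N ≤? length x
    ... | no N≰∣x∣ = x , ≰⇒> N≰∣x∣ , ⊆-refl , refl
    ... | yes N≤∣x∣ with shorter-subword x N≤∣x∣
    ...   | x₁ , shorter , x₁⊆x , fx₁ with go x₁ (rec shorter)
    ...     | x₂ , short , x₂⊆x₁ , fx₂ = x₂ , short , ⊆-trans x₂⊆x₁ x₁⊆x , trans fx₂ fx₁

-- Annotated words

-- An annotated word x encodes the chain level 0 x ⊆ level 1 x ⊆ ⋯ ⊆ erase x:
-- a letter labelled l belongs to the levels l, l + 1, …
Annotated : ℕ → Set
Annotated n = List (Fin n × ℕ)

level : ℕ → Annotated n → Word n
level j [] = []
level j ((a , l) ∷ x) with l ≤? j
... | yes _ = a ∷ level j x
... | no _ = level j x

erase : Annotated n → Word n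
erase = map proj₁

level-++ : ∀ j (x y : Annotated n) → level j (x ++ y) ≡ level j x ++ level j y
level-++ j [] y = refl
level-++ j ((a , l) ∷ x) y with l ≤? j
... | yes _ = cong (a ∷_) (level-++ j x y)
... | no _ = level-++ j x y

level-⊆-suc : ∀ j (x : Annotated n) → level j x ⊆ level (suc j) x
level-⊆-suc j [] = []
level-⊆-suc j ((a , l) ∷ x) with l ≤? j | l ≤? suc j
... | yes _ | yes _ = refl ∷ level-⊆-suc j x
... | no _ | yes _ = a ∷ʳ level-⊆-suc j x
... | no _ | no _ = level-⊆-suc j x
... | yes l≤j | no l≰sj = contradiction (m≤n⇒m≤1+n l≤j) l≰sj

cap : ℕ → Annotated n → Annotated n
cap i = map (Product.map₂ (_⊓ i))

erase-cap : ∀ i (x : Annotated n) → erase (cap i x) ≡ erase x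
erase-cap i x = sym (map-∘ x)

level-cap-< : j < i → (x : Annotated n) → level j (cap i x) ≡ level j x
level-cap-< j<i [] = refl
level-cap-< {j = j} {i = i} j<i ((a , l) ∷ x) with l ⊓ i ≤? j | l ≤? j
... | yes _ | yes _ = cong (a ∷_) (level-cap-< j<i x)
... | no _ | no _ = level-cap-< j<i x
... | yes l⊓i≤j | no l≰j = contradiction l⊓i≤j (<⇒≱ (⊓-glb (≰⇒> l≰j) j<i))
... | no l⊓i≰j | yes l≤j = contradiction (≤-trans (m⊓n≤m l i) l≤j) l⊓i≰j

level-cap-≥ : i ≤ j → (x : Annotated n) → level j (cap i x) ≡ erase x
level-cap-≥ i≤j [] = refl
level-cap-≥ {i = i} {j = j} i≤j ((a , l) ∷ x) with l ⊓ i ≤? j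
... | yes _ = cong (a ∷_) (level-cap-≥ i≤j x)
... | no l⊓i≰j = contradiction (≤-trans (m⊓n≤n l i) i≤j) l⊓i≰j

pad : ℕ → (x : Annotated n) → erase x ⊆ w → Annotated n
pad i [] [] = []
pad i x (b ∷ʳ s) = (b , i) ∷ pad i x s
pad i ((a , l) ∷ x) (refl ∷ s) = (a , l) ∷ pad i x s

erase-pad : (x : Annotated n) (s : erase x ⊆ w) → erase (pad i x s) ≡ w
erase-pad [] [] = refl
erase-pad [] (b ∷ʳ s) = cong (b ∷_) (erase-pad [] s)
erase-pad x@(_ ∷ _) (b ∷ʳ s) = cong (b ∷_) (erase-pad x s)
erase-pad ((a , l) ∷ x) (refl ∷ s) = cong (a ∷_) (erase-pad x s)

level-above : j < i → ∀ (b : Fin n) x → level j ((b , i) ∷ x) ≡ level j x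
level-above {j = j} {i = i} j<i b x with i ≤? j
... | yes i≤j = contradiction i≤j (<⇒≱ j<i)
... | no _ = refl

level-pad : j < i → (x : Annotated n) (s : erase x ⊆ w) → level j (pad i x s) ≡ level j x
level-pad j<i [] [] = refl
level-pad j<i [] (b ∷ʳ s) = trans (level-above j<i b _) (level-pad j<i [] s)
level-pad j<i x@(_ ∷ _) (b ∷ʳ s) = trans (level-above j<i b _) (level-pad j<i x s)
level-pad {j = j} j<i ((a , l) ∷ x) (refl ∷ s) with l ≤? j
... | yes _ = cong (a ∷_) (level-pad j<i x s)
... | no _ = level-pad j<i x s

-- Alternating chains

module _ {n : ℕ} (χ : Word n → Bool) where

  Alternating : ℕ → Annotated n → Set
  Alternating zero x = ⊤
  Alternating (suc d) x = Alternating d x × χ (level d x) ≡ odd (suc d)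

  alternating? : ∀ d → Decidable (Alternating d)
  alternating? zero x = yes tt
  alternating? (suc d) x = alternating? d x ×-dec (χ (level d x) ≟ᵇ odd (suc d))

  Alternating-level₀ : ∀ d {x} → Alternating (suc d) x → χ (level 0 x) ≡ true
  Alternating-level₀ zero (_ , χ≡) = χ≡
  Alternating-level₀ (suc d) (alt , _) = Alternating-level₀ d alt

  Alternating-cap : d ≤ i → (x : Annotated n) → Alternating d x → Alternating d (cap i x)
  Alternating-cap {zero} _ x _ = tt
  Alternating-cap {suc d} d<i x (alt , χ≡) =
    Alternating-cap (<⇒≤ d<i) x alt , trans (cong χ (level-cap-< d<i x)) χ≡

  Alternating-pad : d ≤ i → (x : Annotated n) (s : erase x ⊆ w) →
                    Alternating d x → Alternating d (pad i x s)
  Alternating-pad {zero} _ x s _ = tt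
  Alternating-pad {suc d} d<i x s (alt , χ≡) =
    Alternating-pad (<⇒≤ d<i) x s alt , trans (cong χ (level-pad d<i x s)) χ≡

  -- Chain i w: there is an alternating chain w₀ ⊆ ⋯ ⊆ wᵢ₋₁ ⊆ w.
  Chain : ℕ → Word n → Set
  Chain i w = Σ (Annotated n) λ x → Alternating i x × erase x ≡ w

  Chain-zero : ∀ w → Chain 0 w
  Chain-zero w = pad 0 [] (minimum w) , tt , erase-pad [] (minimum w)

  Chain-pred : Chain (suc i) w → Chain i w
  Chain-pred (x , (alt , _) , x≡w) = x , alt , x≡w

  Chain-extend : Chain i w → χ w ≡ odd (suc i) → Chain (suc i) w
  Chain-extend {i} (x , alt , refl) χ≡ =
    cap i x ,
    (Alternating-cap ≤-refl x alt , trans (cong χ (level-cap-≥ ≤-refl x)) χ≡) ,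
    erase-cap i x

  Chain-upward : u ⊆ w → Chain i u → Chain i w
  Chain-upward s (x , alt , refl) = pad _ x s , Alternating-pad ≤-refl x s alt , erase-pad x s

  maximal-chain⇒χ≡odd : Chain i w → ¬ Chain (suc i) w → χ w ≡ odd i
  maximal-chain⇒χ≡odd {i} c ¬c = trans (¬-not (¬c ∘ Chain-extend c)) (not-involutive (odd i))

  -- The count grows weakly along the chain and changes parity at each step.
  #⊨-level≥ : (φs : Vec (Σ₁Sentence n) k) → (∀ w → χ w ≡ odd (#⊨ φs w)) →
                      ∀ j {x} → Alternating (suc j) x → suc j ≤ #⊨ φs (level j x)
  #⊨-level≥ φs χ≡ zero {x} (_ , χ≡true) with #⊨ φs (level 0 x) | χ≡ (level 0 x)
  ... | suc c | _ = s≤s z≤n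
  ... | zero | χ≡false = contradiction (trans (sym χ≡true) χ≡false) λ ()
  #⊨-level≥ φs χ≡ (suc j) {x} (alt@(_ , χ≡j) , χ≡sj) =
    ≤-<-trans (#⊨-level≥ φs χ≡ j alt)
              (≤∧≢⇒< (#⊨-mono φs (level-⊆-suc j x)) parity-changes)
    where
    parity-changes : #⊨ φs (level j x) ≢ #⊨ φs (level (suc j) x)
    parity-changes eq = not-¬ refl (begin
      odd (suc j)                            ≡⟨ trans (sym χ≡j) (χ≡ _) ⟩
      odd (#⊨ φs (level j x))               ≡⟨ cong odd eq ⟩
      odd (#⊨ φs (level (suc j) x))         ≡⟨ trans (sym (χ≡ _)) χ≡sj ⟩
      not (odd (suc j))                      ∎)
      where open ≡-Reasoning

  InΣ₁⇒¬alternating : InΣ₁ k (λ w → χ w ≡ true) → ¬ ∃ (Alternating (suc k))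
  InΣ₁⇒¬alternating {k} (φs , L⇔φs) (x , alt) =
    <⇒≱ (#⊨-level≥ φs χ≡ k alt) (count≤n _ φs)
    where
    χ≡ : ∀ w → χ w ≡ odd (#⊨ φs w)
    χ≡ w = ⇔→≡ (⇔.trans (L⇔φs w) (SymDiff⇔odd φs w))

lists : ℕ → List A → List (List A)
lists zero as = [] ∷ []
lists (suc ℓ) as = [] ∷ cartesianProductWith _∷_ as (lists ℓ as)

∈-lists : {as z : List A} → All (_∈ as) z → length z ≤ ℓ → z ∈ lists ℓ as
∈-lists {ℓ = zero} [] _ = here refl
∈-lists {ℓ = suc ℓ} [] _ = here refl
∈-lists {ℓ = suc ℓ} (a∈as ∷ z∈as) (s≤s ∣z∣≤ℓ) =
  there (∈-cartesianProductWith⁺ _∷_ a∈as (∈-lists z∈as ∣z∣≤ℓ))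

accepts : DFA n → Word n → Bool
accepts F w = DFA.final F (run F (DFA.initial F) w)

run-++ : (F : DFA n) (q : Fin (DFA.Q F)) (u v : Word n) → run F q (u ++ v) ≡ run F (run F q u) v
run-++ F q [] v = refl
run-++ F q (a ∷ u) v = run-++ F (DFA.δ F q a) u v

module _ {n : ℕ} (F : DFA n) where
  open DFA F

  private
    χ : Word n → Bool
    χ = accepts F

    reach : Word n → Fin Q
    reach = run F initial

  -- The state of the product of d copies of F, the j-th copy reading level j.
  levelStates : (d : ℕ) → Annotated n → Fin (Q ^ d)
  levelStates zero x = zero
  levelStates (suc d) x = combine (reach (level d x)) (levelStates d x)

  levelStates-++ : ∀ d {x y} z → levelStates d x ≡ levelStates d y →
                   levelStates d (x ++ z) ≡ levelStates d (y ++ z)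
  levelStates-++ zero z _ = refl
  levelStates-++ (suc d) {x} {y} z eq with combine-injective _ _ _ _ eq
  ... | qx≡qy , rest = cong₂ combine reach-++ (levelStates-++ d z rest)
    where
    open ≡-Reasoning
    reach-++ : reach (level d (x ++ z)) ≡ reach (level d (y ++ z))
    reach-++ = begin
      reach (level d (x ++ z))                ≡⟨ cong reach (level-++ d x z) ⟩
      reach (level d x ++ level d z)          ≡⟨ run-++ F initial (level d x) (level d z) ⟩
      run F (reach (level d x)) (level d z)   ≡⟨ cong (λ q → run F q (level d z)) qx≡qy ⟩
      run F (reach (level d y)) (level d z)   ≡⟨ run-++ F initial (level d y) (level d z) ⟨
      reach (level d y ++ level d z)          ≡⟨ cong reach (level-++ d y z) ⟨
      reach (level d (y ++ z))                ∎

  Alternating-levelStates : ∀ d {x y} → levelStates d x ≡ levelStates d y →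
                            Alternating χ d y → Alternating χ d x
  Alternating-levelStates zero _ _ = tt
  Alternating-levelStates (suc d) eq (alt , χ≡) with combine-injective _ _ _ _ eq
  ... | qx≡qy , rest = Alternating-levelStates d rest alt , trans (cong final qx≡qy) χ≡

  candidates : ℕ → List (Annotated n)
  candidates d = lists (Q ^ d) (cartesianProduct (allFin n) (upTo (suc d)))

  cap-∈-candidates : ∀ d (x : Annotated n) → length x ≤ Q ^ d → cap d x ∈ candidates d
  cap-∈-candidates d x ∣x∣≤ =
    ∈-lists (All.map⁺ (All.universal letter∈ x)) (subst (_≤ Q ^ d) (sym (length-map _ x)) ∣x∣≤)
    where
    letter∈ : ∀ ((a , l) : Fin n × ℕ) → (a , l ⊓ d) ∈ cartesianProduct (allFin n) (upTo (suc d))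
    letter∈ (a , l) = ∈-cartesianProduct⁺ (∈-allFin a) (∈-upTo⁺ (s≤s (m⊓n≤n l d)))

  -- Pumping the chain down against F and capping its labels at d gives a candidate.
  short-alternating : ∀ d {x} → Alternating χ d x →
                      ∃ λ z → z ∈ candidates d × Alternating χ d z × erase z ⊆ erase x
  short-alternating d {x} alt with short-subword (levelStates d) (levelStates-++ d) x
  ... | x′ , short , x′⊆x , same =
    cap d x′ ,
    cap-∈-candidates d x′ (<⇒≤ short) ,
    Alternating-cap χ ≤-refl x′ (Alternating-levelStates d same alt) ,
    subst (_⊆ erase x) (sym (erase-cap d x′)) (map⁺ proj₁ x′⊆x)

  alternating-exists? : ∀ d → Dec (∃ (Alternating χ d))
  alternating-exists? d =
    map′ (λ any → let z , _ , alt = find any in z , alt)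
         (λ (_ , alt) → let z , z∈ , alt′ , _ = short-alternating d alt in lose z∈ alt′)
         (Any.any? (alternating? χ d) (candidates d))

  alternatingCandidates : ℕ → List (Annotated n)
  alternatingCandidates i = filter (alternating? χ i) (candidates i)

  chainSentence : ℕ → Σ₁Sentence n
  chainSentence i = ⋁ (map (↑ ∘ erase) (alternatingCandidates i))

  chainSentence-sound : ∀ i {w} → w ⊨ chainSentence i → Chain χ i w
  chainSentence-sound i {w} p
    with find (Any.map⁻ (⋁⁻ {w = w} (map (↑ ∘ erase) (alternatingCandidates i)) p))
  ... | z , z∈ , w⊨↑z = Chain-upward χ (↑-sound (erase z) w⊨↑z) (z , alt , refl)
    where
    alt : Alternating χ i z
    alt = proj₂ (∈-filter⁻ (alternating? χ i) {xs = candidates i} z∈)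

  chainSentence-complete : χ [] ≡ false → ∀ i {w} → Chain χ (suc i) w → w ⊨ chainSentence (suc i)
  chainSentence-complete χ[]≡false i (x , alt , refl) with short-alternating (suc i) alt
  ... | z , z∈ , alt′ , z⊆x =
    ⋁⁺ (Any.map⁺ (lose (∈-filter⁺ (alternating? χ (suc i)) z∈ alt′) (⊨↑ z alt′ z⊆x)))
    where
    ⊨↑ : (z : Annotated n) → Alternating χ (suc i) z → erase z ⊆ erase x → erase x ⊨ ↑ (erase z)
    ⊨↑ [] alt′ _ = contradiction (trans (sym χ[]≡false) (Alternating-level₀ χ i alt′)) λ ()
    ⊨↑ (_ ∷ _) _ z⊆x = ↑-complete z⊆x

  levels : ℕ → (len : ℕ) → Vec (Σ₁Sentence n) len
  levels s zero = []
  levels s (suc len) = chainSentence (suc s) ∷ levels (suc s) len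

  #⊨-levels-above : ¬ Chain χ s w → ∀ len → #⊨ (levels s len) w ≡ 0
  #⊨-levels-above ¬c zero = refl
  #⊨-levels-above {s} {w} ¬c (suc len) with w ⊨? chainSentence (suc s)
  ... | yes p = contradiction (Chain-pred χ (chainSentence-sound (suc s) p)) ¬c
  ... | no _ = #⊨-levels-above (¬c ∘ Chain-pred χ) len

  -- w is accepted iff the longest alternating chain below w has odd length.
  levels-parity : χ [] ≡ false → ∀ s len → Chain χ s w → ¬ Chain χ (suc (s + len)) w →
                   χ w ≡ odd (s + #⊨ (levels s len) w)
  levels-parity _ s zero c ¬c rewrite +-identityʳ s = maximal-chain⇒χ≡odd χ c ¬c
  levels-parity {w} χ[]≡false s (suc len) c ¬c with w ⊨? chainSentence (suc s)
  ... | yes p = begin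
    χ w
      ≡⟨ levels-parity χ[]≡false (suc s) len (chainSentence-sound (suc s) p) ¬c′ ⟩
    odd (suc s + #⊨ (levels (suc s) len) w)      ≡⟨ cong odd (+-suc s _) ⟨
    odd (s + suc (#⊨ (levels (suc s) len) w))    ∎
    where
    open ≡-Reasoning
    ¬c′ : ¬ Chain χ (suc (suc s + len)) w
    ¬c′ = ¬c ∘ subst (λ t → Chain χ (suc t) w) (sym (+-suc s len))
  ... | no ¬p = begin
    χ w                                    ≡⟨ maximal-chain⇒χ≡odd χ c ¬c₁ ⟩
    odd s                                  ≡⟨ cong odd (+-identityʳ s) ⟨
    odd (s + 0)                            ≡⟨ cong (λ c → odd (s + c)) (#⊨-levels-above ¬c₁ len) ⟨
    odd (s + #⊨ (levels (suc s) len) w)    ∎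
    where
    open ≡-Reasoning
    ¬c₁ : ¬ Chain χ (suc s) w
    ¬c₁ = ¬p ∘ chainSentence-complete χ[]≡false s

  L⇔SymDiff-levels : χ [] ≡ false → ¬ ∃ (Alternating χ (suc k)) →
                     ∀ w → L[ F ] w ⇔ SymDiff (levels 0 k) w
  L⇔SymDiff-levels {k} χ[]≡false ¬alt w =
    ⇔.trans (mk⇔ (trans (sym χ≡)) (trans χ≡)) (⇔.sym (SymDiff⇔odd (levels 0 k) w))
    where
    χ≡ : χ w ≡ odd (#⊨ (levels 0 k) w)
    χ≡ = levels-parity χ[]≡false 0 k (Chain-zero χ w) (λ (x , alt , _) → ¬alt (x , alt))

  InΣ₁⇔ : InΣ₁ k L[ F ] ⇔ (χ [] ≡ false × ¬ ∃ (Alternating χ (suc k)))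
  InΣ₁⇔ {k} = mk⇔ (λ I → ¬-not (InΣ₁⇒[]∉ I) , InΣ₁⇒¬alternating χ I)
                  (λ (χ[]≡false , ¬alt) → levels 0 k , L⇔SymDiff-levels χ[]≡false ¬alt)

inΣ₁? : ∀ k (F : DFA n) → Dec (InΣ₁ k L[ F ])
inΣ₁? k F = map′ (from (InΣ₁⇔ F)) (to (InΣ₁⇔ F))
                 ((accepts F [] ≟ᵇ false) ×-dec ¬? (alternating-exists? F (suc k)))

complement : DFA n → DFA n
complement F = record F { final = not ∘ DFA.final F }

run-complement : (F : DFA n) (q : Fin (DFA.Q F)) (w : Word n) → run (complement F) q w ≡ run F q w
run-complement F q [] = refl
run-complement F q (a ∷ w) = run-complement F (DFA.δ F q a) w

L[complement]⇔∁ : (F : DFA n) (w : Word n) → L[ complement F ] w ⇔ ∁ L[ F ] w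
L[complement]⇔∁ F w rewrite run-complement F (DFA.initial F) w = not≡true⇔≢true

inCoΣ₁? : ∀ k (F : DFA n) → Dec (InCoΣ₁ k L[ F ])
inCoΣ₁? k F = map′ (InΣ₁-cong (L[complement]⇔∁ F)) (InΣ₁-cong (⇔.sym ∘ L[complement]⇔∁ F))
                   (inΣ₁? k (complement F))

corollary4p8 : (n : ℕ) → 2 ≤ n → (k : ℕ) → 1 ≤ k →
    ((F : DFA n) → Dec (InΣ₁ k L[ F ])) × ((F : DFA n) → Dec (InCoΣ₁ k L[ F ]))
corollary4p8 n _ k _ = inΣ₁? k , inCoΣ₁? k
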